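{- For all $n\ge0$, \[ c_n^2=c_n+2\sum_{k=0}^{n-3}\sum_{r=3}^{n-k}p_{r-1}c_{k}c_{n-k-r}^2 . \]
   Context: The Narayana's cows numbers $c_n$ are defined by $c_n=\delta_{n,0}+c_{n-1}+c_{n-3}$ for $n\ge0$, $c_n=0$ for $n<0$. The Padovan numbers $p_n$ are defined by $p_n=\delta_{n,0}+p_{n-2}+p_{n-3}$ for $n\ge0$, $p_n=0$ for $n<0$. $\delta_{i,j}$ is $1$ if $i=j$ and $0$ otherwise; empty sums are $0$. -}

module Defs where

open import Data.Nat using (ℕ; zero; suc; _+_; _*_; _∸_)

-- Narayana's cows numbers: c_n = δ_{n,0} + c_{n-1} + c_{n-3}, c_n = 0 for n < 0.
-- (Values at negative indices are 0, so only n ≥ 0 is represented.)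
cow : ℕ → ℕ
cow zero = 1
cow (suc zero) = cow zero
cow (suc (suc zero)) = cow (suc zero)
cow (suc (suc (suc n))) = cow (suc (suc n)) + cow n

-- Padovan numbers: p_n = δ_{n,0} + p_{n-2} + p_{n-3}, p_n = 0 for n < 0.
pad : ℕ → ℕ
pad zero = 1
pad (suc zero) = 0
pad (suc (suc zero)) = pad zero
pad (suc (suc (suc n))) = pad (suc n) + pad n

sumRange : ℕ → ℕ → (ℕ → ℕ) → ℕ
sumRange a zero f = 0
sumRange a (suc m) f = sumRange a m f + f (a + m)

-- Σ_{i=a}^{b} f i  (integer bounds a ≤ b+1 … ; empty when b < a).
-- Number of terms is (b + 1) ∸ a, which is 0 exactly when b < a.
sumFromTo : ℕ → ℕ → (ℕ → ℕ) → ℕ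
sumFromTo a b f = sumRange a (suc b ∸ a) f

{-# OPTIONS --safe #-}
-- Write Q_m = Σ_{r=3}^{m} p_{r-1} c_{m-r}² (innerSum below). The heart of the matter is
-- Q_{m+3} = c_{m+2} c_m, proved by induction from the Padovan recurrence
-- p_{j+5} = p_{j+3} + p_{j+2}. Squaring c_{m+3} = c_{m+2} + c_m then shows that c²
-- satisfies the cows recurrence with inhomogeneity 2 Q, whose solution is c + 2 (c ⋆ Q);
-- the double sum of the theorem is (c ⋆ Q)_n with the zero terms Q_0 = Q_1 = Q_2 = 0 cut off.
module Submission where

open import Defs
open import Data.Nat using (ℕ; zero; suc; _+_; _*_; _∸_; _≤_; s≤s)
open import Data.Nat.Properties
  using (+-assoc; +-identityʳ; *-zeroʳ; *-distribˡ-+; *-distribʳ-+; m≤n+m;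
         m≤n⇒m∸n≡0; ∸-monoʳ-≤; m+n∸n≡m; ≤-trans; ≤-reflexive)
open import Data.Nat.Tactic.RingSolver using (solve-∀)
open import Relation.Binary.PropositionalEquality
open ≡-Reasoning

sumRange-cong : ∀ a N {f g : ℕ → ℕ} → (∀ j → f j ≡ g j) → sumRange a N f ≡ sumRange a N g
sumRange-cong a zero    f≗g = refl
sumRange-cong a (suc N) f≗g = cong₂ _+_ (sumRange-cong a N f≗g) (f≗g (a + N))

sumRange-+ : ∀ a N (f g : ℕ → ℕ) →
  sumRange a N (λ j → f j + g j) ≡ sumRange a N f + sumRange a N g
sumRange-+ a zero    f g = refl
sumRange-+ a (suc N) f g = begin
  sumRange a N (λ j → f j + g j) + (f (a + N) + g (a + N))
    ≡⟨ cong (_+ (f (a + N) + g (a + N))) (sumRange-+ a N f g) ⟩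
  sumRange a N f + sumRange a N g + (f (a + N) + g (a + N))
    ≡⟨ interchange (sumRange a N f) (sumRange a N g) (f (a + N)) (g (a + N)) ⟩
  sumRange a N f + f (a + N) + (sumRange a N g + g (a + N)) ∎
  where
  interchange : ∀ w x y z → w + x + (y + z) ≡ w + y + (x + z)
  interchange = solve-∀

sumRange-*ˡ : ∀ a N c (f : ℕ → ℕ) → sumRange a N (λ j → c * f j) ≡ c * sumRange a N f
sumRange-*ˡ a zero    c f = sym (*-zeroʳ c)
sumRange-*ˡ a (suc N) c f =
  trans (cong (_+ c * f (a + N)) (sumRange-*ˡ a N c f)) (sym (*-distribˡ-+ c _ _))

sumRange-shift : ∀ a N (f : ℕ → ℕ) → sumRange a N f ≡ sumRange 0 N (λ j → f (a + j))
sumRange-shift a zero    f = refl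
sumRange-shift a (suc N) f = cong (_+ f (a + N)) (sumRange-shift a N f)

sumRange-uncons : ∀ N (f : ℕ → ℕ) → sumRange 0 (suc N) f ≡ f 0 + sumRange 0 N (λ j → f (suc j))
sumRange-uncons zero    f = sym (+-identityʳ (f 0))
sumRange-uncons (suc N) f =
  trans (cong (_+ f (suc N)) (sumRange-uncons N f)) (+-assoc (f 0) _ _)

sumRange-vanishing-tail : ∀ K N (f : ℕ → ℕ) → (∀ j → N ≤ j → f j ≡ 0) →
  sumRange 0 (K + N) f ≡ sumRange 0 N f
sumRange-vanishing-tail zero    N f f≡0 = refl
sumRange-vanishing-tail (suc K) N f f≡0 = begin
  sumRange 0 (K + N) f + f (K + N) ≡⟨ cong₂ _+_ (sumRange-vanishing-tail K N f f≡0) (f≡0 (K + N) (m≤n+m N K)) ⟩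
  sumRange 0 N f + 0                ≡⟨ +-identityʳ _ ⟩
  sumRange 0 N f                    ∎

infixl 7 _⋆_

_⋆_ : (ℕ → ℕ) → (ℕ → ℕ) → ℕ → ℕ
(f ⋆ g) n = sumRange 0 (suc n) (λ j → f j * g (n ∸ j))

⋆-+ˡ : ∀ (f f′ g : ℕ → ℕ) n → ((λ j → f j + f′ j) ⋆ g) n ≡ (f ⋆ g) n + (f′ ⋆ g) n
⋆-+ˡ f f′ g n = trans (sumRange-cong 0 (suc n) (λ j → *-distribʳ-+ (g (n ∸ j)) (f j) (f′ j)))
                      (sumRange-+ 0 (suc n) _ _)

⋆-suc : ∀ (f g : ℕ → ℕ) n → (f ⋆ g) (suc n) ≡ f 0 * g (suc n) + ((λ j → f (suc j)) ⋆ g) n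
⋆-suc f g n = sumRange-uncons (suc n) (λ j → f j * g (suc n ∸ j))

⋆-suc² : ∀ (f g : ℕ → ℕ) m →
  (f ⋆ g) (2 + m) ≡ f 0 * g (2 + m) + (f 1 * g (1 + m) + ((λ j → f (2 + j)) ⋆ g) m)
⋆-suc² f g m = trans (⋆-suc f g (1 + m)) (cong (f 0 * g (2 + m) +_) (⋆-suc (λ j → f (suc j)) g m))

⋆-suc³ : ∀ (f g : ℕ → ℕ) m →
  (f ⋆ g) (3 + m) ≡
    f 0 * g (3 + m) + (f 1 * g (2 + m) + (f 2 * g (1 + m) + ((λ j → f (3 + j)) ⋆ g) m))
⋆-suc³ f g m = trans (⋆-suc f g (2 + m)) (cong (f 0 * g (3 + m) +_) (⋆-suc² (λ j → f (suc j)) g m))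

⋆-cowˡ : ∀ (g : ℕ → ℕ) m → (cow ⋆ g) (3 + m) ≡ g (3 + m) + ((cow ⋆ g) (2 + m) + (cow ⋆ g) m)
⋆-cowˡ g m = begin
  (cow ⋆ g) (3 + m)
    ≡⟨ ⋆-suc³ cow g m ⟩
  1 * g (3 + m) + (B + (C + (cow₃ ⋆ g) m))
    ≡⟨ cong (λ x → 1 * g (3 + m) + (B + (C + x))) (⋆-+ˡ cow₂ cow g m) ⟩
  1 * g (3 + m) + (B + (C + ((cow₂ ⋆ g) m + (cow ⋆ g) m)))
    ≡⟨ regroup (g (3 + m)) B C ((cow₂ ⋆ g) m) ((cow ⋆ g) m) ⟩
  g (3 + m) + ((B + (C + (cow₂ ⋆ g) m)) + (cow ⋆ g) m)
    ≡⟨ cong (λ x → g (3 + m) + (x + (cow ⋆ g) m)) (sym (⋆-suc² cow g m)) ⟩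
  g (3 + m) + ((cow ⋆ g) (2 + m) + (cow ⋆ g) m) ∎
  where
  B = cow 1 * g (2 + m)
  C = cow 2 * g (1 + m)
  cow₂ cow₃ : ℕ → ℕ
  cow₂ j = cow (2 + j)
  cow₃ j = cow (3 + j)
  regroup : ∀ a b c x y → 1 * a + (b + (c + (x + y))) ≡ a + ((b + (c + x)) + y)
  regroup = solve-∀

pad₂ : ℕ → ℕ
pad₂ j = pad (2 + j)

⋆-pad₂ˡ : ∀ (g : ℕ → ℕ) m →
  (pad₂ ⋆ g) (3 + m) ≡ g (3 + m) + (g (2 + m) + ((pad₂ ⋆ g) (1 + m) + (pad₂ ⋆ g) m))
⋆-pad₂ˡ g m = begin
  (pad₂ ⋆ g) (3 + m)
    ≡⟨ ⋆-suc³ pad₂ g m ⟩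
  1 * g (3 + m) + (1 * g (2 + m) + (C + (pad₅ ⋆ g) m))
    ≡⟨ cong (λ x → 1 * g (3 + m) + (1 * g (2 + m) + (C + x))) (⋆-+ˡ pad₃ pad₂ g m) ⟩
  1 * g (3 + m) + (1 * g (2 + m) + (C + ((pad₃ ⋆ g) m + (pad₂ ⋆ g) m)))
    ≡⟨ regroup (g (3 + m)) (g (2 + m)) C ((pad₃ ⋆ g) m) ((pad₂ ⋆ g) m) ⟩
  g (3 + m) + (g (2 + m) + ((C + (pad₃ ⋆ g) m) + (pad₂ ⋆ g) m))
    ≡⟨ cong (λ x → g (3 + m) + (g (2 + m) + (x + (pad₂ ⋆ g) m))) (sym (⋆-suc pad₂ g m)) ⟩
  g (3 + m) + (g (2 + m) + ((pad₂ ⋆ g) (1 + m) + (pad₂ ⋆ g) m)) ∎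
  where
  C = pad₂ 2 * g (1 + m)
  pad₃ pad₅ : ℕ → ℕ
  pad₃ j = pad (3 + j)
  pad₅ j = pad (5 + j)
  regroup : ∀ a b c x y → 1 * a + (1 * b + (c + (x + y))) ≡ a + (b + ((c + x) + y))
  regroup = solve-∀

cow² : ℕ → ℕ
cow² n = cow n * cow n

⋆-pad₂-cow² : ∀ m → (pad₂ ⋆ cow²) m ≡ cow (2 + m) * cow m
⋆-pad₂-cow² 0 = refl
⋆-pad₂-cow² 1 = refl
⋆-pad₂-cow² 2 = refl
⋆-pad₂-cow² (suc (suc (suc m))) = begin
  (pad₂ ⋆ cow²) (3 + m)
    ≡⟨ ⋆-pad₂ˡ cow² m ⟩
  cow² (3 + m) + (cow² (2 + m) + ((pad₂ ⋆ cow²) (1 + m) + (pad₂ ⋆ cow²) m))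
    ≡⟨ cong (λ x → cow² (3 + m) + (cow² (2 + m) + x)) (cong₂ _+_ (⋆-pad₂-cow² (suc m)) (⋆-pad₂-cow² m)) ⟩
  cow² (3 + m) + (cow² (2 + m) + (cow (3 + m) * cow (1 + m) + cow (2 + m) * cow m))
    ≡⟨ algebra (cow m) (cow (1 + m)) (cow (2 + m)) ⟩
  cow (5 + m) * cow (3 + m) ∎
  where
  algebra : ∀ a b d →
    (d + a) * (d + a) + (d * d + ((d + a) * b + d * a)) ≡ (d + a + b + d) * (d + a)
  algebra = solve-∀

innerSum : ℕ → ℕ
innerSum m = sumFromTo 3 m (λ r → pad (r ∸ 1) * cow² (m ∸ r))

innerSum-3+ : ∀ m → innerSum (3 + m) ≡ cow (2 + m) * cow m
innerSum-3+ m = begin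
  innerSum (3 + m)       ≡⟨ sumRange-shift 3 (suc m) _ ⟩
  (pad₂ ⋆ cow²) m        ≡⟨ ⋆-pad₂-cow² m ⟩
  cow (2 + m) * cow m    ∎

innerSum-vanishes : ∀ {j} → j ≤ 2 → innerSum j ≡ 0
innerSum-vanishes {j} j≤2 = cong (λ N → sumRange 3 N (λ r → pad (r ∸ 1) * cow² (j ∸ r))) (m≤n⇒m∸n≡0 (s≤s j≤2))

cow²-3+ : ∀ m → cow² (3 + m) ≡ cow² (2 + m) + cow² m + 2 * innerSum (3 + m)
cow²-3+ m rewrite innerSum-3+ m = algebra (cow m) (cow (2 + m))
  where
  algebra : ∀ a d → (d + a) * (d + a) ≡ d * d + a * a + 2 * (d * a)
  algebra = solve-∀

cow²≡cow+2⋆ : ∀ n → cow² n ≡ cow n + 2 * (cow ⋆ innerSum) n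
cow²≡cow+2⋆ 0 = refl
cow²≡cow+2⋆ 1 = refl
cow²≡cow+2⋆ 2 = refl
cow²≡cow+2⋆ (suc (suc (suc m))) = begin
  cow² (3 + m)
    ≡⟨ cow²-3+ m ⟩
  cow² (2 + m) + cow² m + 2 * innerSum (3 + m)
    ≡⟨ cong (_+ 2 * innerSum (3 + m)) (cong₂ _+_ (cow²≡cow+2⋆ (suc (suc m))) (cow²≡cow+2⋆ m)) ⟩
  (cow (2 + m) + 2 * H (2 + m)) + (cow m + 2 * H m) + 2 * innerSum (3 + m)
    ≡⟨ algebra (cow (2 + m)) (H (2 + m)) (cow m) (H m) (innerSum (3 + m)) ⟩
  cow (3 + m) + 2 * (innerSum (3 + m) + (H (2 + m) + H m))
    ≡⟨ cong (λ x → cow (3 + m) + 2 * x) (sym (⋆-cowˡ innerSum m)) ⟩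
  cow (3 + m) + 2 * H (3 + m) ∎
  where
  H : ℕ → ℕ
  H = cow ⋆ innerSum
  algebra : ∀ c₂ h₂ c₀ h₀ q → (c₂ + 2 * h₂) + (c₀ + 2 * h₀) + 2 * q ≡ (c₂ + c₀) + 2 * (q + (h₂ + h₀))
  algebra = solve-∀

⋆-innerSum-truncate : ∀ n → sumRange 0 (n ∸ 2) (λ k → cow k * innerSum (n ∸ k)) ≡ (cow ⋆ innerSum) n
⋆-innerSum-truncate 0 = refl
⋆-innerSum-truncate 1 = refl
⋆-innerSum-truncate (suc (suc m)) = sym (sumRange-vanishing-tail 3 m _ vanishing)
  where
  vanishing : ∀ k → m ≤ k → cow k * innerSum (2 + m ∸ k) ≡ 0
  vanishing k m≤k = trans (cong (cow k *_) (innerSum-vanishes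
    (≤-trans (∸-monoʳ-≤ (2 + m) m≤k) (≤-reflexive (m+n∸n≡m 2 m))))) (*-zeroʳ (cow k))

mainTheorem17 : (n : ℕ) →
    cow n * cow n ≡
      cow n + 2 * sumRange 0 (n ∸ 2) (λ k →
        sumFromTo 3 (n ∸ k) (λ r →
          pad (r ∸ 1) * cow k * (cow (n ∸ k ∸ r) * cow (n ∸ k ∸ r))))
mainTheorem17 n = begin
  cow² n
    ≡⟨ cow²≡cow+2⋆ n ⟩
  cow n + 2 * (cow ⋆ innerSum) n
    ≡⟨ cong (λ x → cow n + 2 * x) (sym (⋆-innerSum-truncate n)) ⟩
  cow n + 2 * sumRange 0 (n ∸ 2) (λ k → cow k * innerSum (n ∸ k))
    ≡⟨ cong (λ x → cow n + 2 * x) (sumRange-cong 0 (n ∸ 2) (λ k → sym (factor-cow k))) ⟩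
  cow n + 2 * sumRange 0 (n ∸ 2) (λ k →
    sumFromTo 3 (n ∸ k) (λ r → pad (r ∸ 1) * cow k * cow² (n ∸ k ∸ r))) ∎
  where
  factor-cow : ∀ k →
    sumFromTo 3 (n ∸ k) (λ r → pad (r ∸ 1) * cow k * cow² (n ∸ k ∸ r)) ≡ cow k * innerSum (n ∸ k)
  factor-cow k = trans
    (sumRange-cong 3 (suc (n ∸ k) ∸ 3) (λ r → *-comm-middle (pad (r ∸ 1)) (cow k) (cow² (n ∸ k ∸ r))))
    (sumRange-*ˡ 3 (suc (n ∸ k) ∸ 3) (cow k) _)
    where
    *-comm-middle : ∀ a c x → a * c * x ≡ c * (a * x)
    *-comm-middle = solve-∀
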